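{- A class $\mathcal{C}$ of SD-models is definable in $\mathcal{L}_{\mathcal{U}}$ (i.e., there is a formula $\varphi$ of $\mathcal{L}_{\mathcal{U}}$ such that for every SD-model $W$, $W\models\varphi$ iff $W\in\mathcal{C}$) if and only if $\mathcal{C}$ is closed under finite propositional equivalence.
   Context: Fix a countably infinite set $\mathit{PROP}$ of proposition symbols; assignments are maps $w:\mathit{PROP}\to\{0,1\}$; an SD-model is a (possibly empty) set $W$ of assignments. $\mathcal{L}_{\mathcal{U}}$: formulae $\varphi::=p\mid\neg\varphi\mid(\varphi\to\varphi)\mid[\mathsf{U}]\varphi$, $p\in\mathit{PROP}$. Semantics at $w\in W$: $W,w\models p$ iff $w(p)=1$; $\neg,\to$ classical; $W,w\models[\mathsf{U}]\varphi$ iff $W,u\models\varphi$ for all $u\in W$. $W\models\varphi$ means $W,w\models\varphi$ for all $w\in W$ (so $\emptyset\models\varphi$ for every $\varphi$). For $\Phi\subseteq\mathit{PROP}$, $W|_\Phi=\{w|_\Phi: w\in W\}$, and SD-models $W_1,W_2$ are $\Phi$-equivalent if $W_1|_\Phi=W_2|_\Phi$. A class $\mathcal{C}$ of SD-models is closed under finite propositional equivalence if (1) $\emptyset\in\mathcal{C}$ and (2) there is a finite $\Phi\subseteq\mathit{PROP}$ such that for all nonempty SD-models $W_1,W_2$, if $W_1\in\mathcal{C}$ and $W_1,W_2$ are $\Phi$-equivalent, then $W_2\in\mathcal{C}$. -}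

module Defs where

open import Level using (Level; _⊔_; Setω) renaming (suc to lsuc)
open import Data.Nat using (ℕ)
open import Data.Bool using (Bool; true)
open import Data.List using (List)
open import Data.List.Membership.Propositional using (_∈_)
open import Data.Product using (Σ; ∃; _×_)
open import Data.Sum using (_⊎_)
open import Data.Empty using (⊥)
open import Relation.Nullary using (¬_)
open import Relation.Binary.PropositionalEquality using (_≡_)

PROP : Set
PROP = ℕ

Assignment : Set
Assignment = PROP → Bool

-- SD-model: a (possibly empty) set of assignments, as a predicate.
SDModel : Set₁
SDModel = Assignment → Set

data Form : Set where
  var  : PROP → Form
  neg  : Form → Form
  _⇒_  : Form → Form → Form
  [U]_ : Form → Form

-- Satisfaction W , w ⊨ φ  (meaningful for w ∈ W).
_,_⊨_ : SDModel → Assignment → Form → Set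
W , w ⊨ var p   = w p ≡ true
W , w ⊨ neg φ   = ¬ (W , w ⊨ φ)
W , w ⊨ (φ ⇒ ψ) = W , w ⊨ φ → W , w ⊨ ψ
W , w ⊨ ([U] φ) = ∀ u → W u → W , u ⊨ φ

_⊨_ : SDModel → Form → Set
W ⊨ φ = ∀ w → W w → W , w ⊨ φ

Class : (ℓ : Level) → Set (lsuc Level.zero ⊔ lsuc ℓ)
Class ℓ = SDModel → Set ℓ

Definable : ∀ {ℓ} → Class ℓ → Set (lsuc Level.zero ⊔ ℓ)
Definable C = Σ Form λ φ → ∀ (W : SDModel) → (W ⊨ φ → C W) × (C W → W ⊨ φ)

-- Finite sets of proposition symbols are represented by lists.
-- w₁ and w₂ agree on Φ, i.e. w₁|_Φ = w₂|_Φ.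
AgreeOn : List PROP → Assignment → Assignment → Set
AgreeOn Φ w₁ w₂ = ∀ p → p ∈ Φ → w₁ p ≡ w₂ p

PhiEquivalent : List PROP → SDModel → SDModel → Set
PhiEquivalent Φ W₁ W₂ =
  (∀ w₁ → W₁ w₁ → ∃ λ w₂ → W₂ w₂ × AgreeOn Φ w₁ w₂) ×
  (∀ w₂ → W₂ w₂ → ∃ λ w₁ → W₁ w₁ × AgreeOn Φ w₁ w₂)

Empty : SDModel → Set
Empty W = ∀ w → ¬ W w

Nonempty : SDModel → Set
Nonempty W = ∃ λ w → W w

-- Closed under finite propositional equivalence.
-- (1) is stated extensionally: every empty SD-model belongs to C.
ClosedFPE : ∀ {ℓ} → Class ℓ → Set (lsuc Level.zero ⊔ ℓ)
ClosedFPE C =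
  (∀ W → Empty W → C W) ×
  (Σ (List PROP) λ Φ → ∀ W₁ W₂ → Nonempty W₁ → Nonempty W₂ →
      C W₁ → PhiEquivalent Φ W₁ W₂ → C W₂)

-- Classical logic (excluded middle), as the paper's metatheory.
ExcludedMiddle : Setω
ExcludedMiddle = ∀ {ℓ} (P : Set ℓ) → P ⊎ ¬ P

module Submission where

-- Satisfaction of φ at w depends only on w and, through [U], on W, restricted to
-- vars φ; hence Φ-equivalent models agree on formulas with variables in Φ.
-- Conversely, a nonempty model is determined up to Φ-equivalence by the set of
-- Φ-types it realizes, and realizing the type of t is expressed by ◇ χ Φ t, where
-- χ Φ t is the conjunction of the literals of t on Φ. A decision tree branching on
-- these finitely many sentences, with leaf ⊤ exactly when some nonempty member of
-- C has the profile of that branch, defines C by closure under Φ-equivalence; it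
-- holds vacuously in ∅. Excluded middle chooses the leaves and reads conjunction
-- and ◇ off their encodings by ¬, ⇒ and [U].

open import Defs
open import Level using (Level)
open import Data.Bool using (Bool; true; false)
open import Data.Bool.Properties using (not-¬; ¬-not)
open import Data.Nat using (_≟_)
open import Data.List using (List; []; _∷_; _++_; map)
open import Data.List.Membership.Propositional using (_∈_)
open import Data.List.Membership.Propositional.Properties using (∈-++⁺ˡ; ∈-++⁺ʳ; ∈-map⁺)
open import Data.List.Relation.Binary.Subset.Propositional using (_⊆_)
open import Data.List.Relation.Binary.Subset.Propositional.Properties
  using (⊆-refl; ⊆-trans; xs⊆xs++ys; xs⊆ys++xs)
open import Data.List.Relation.Unary.Any using (here; there)
open import Data.List.Relation.Unary.All using (All; []; _∷_; lookup)
open import Data.Product using (∃; _×_; _,_; proj₁; proj₂)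
open import Data.Sum using (_⊎_; inj₁; inj₂)
open import Data.Empty using (⊥-elim)
open import Function using (_∘_)
open import Function.Bundles using (_⇔_; mk⇔; Equivalence)
open import Relation.Nullary using (¬_; yes; no)
open import Relation.Binary.PropositionalEquality using (_≡_; refl; sym; trans)

open Equivalence using (to; from)

private
  variable
    W : SDModel
    w : Assignment

-- `W , w ⊨ φ` from the definitions parses ambiguously next to the pair constructor.
infix 4 _∣_⊨_
_∣_⊨_ : SDModel → Assignment → Form → Set
W ∣ w ⊨ φ = _,_⊨_ W w φ

vars : Form → List PROP
vars (var p) = p ∷ []
vars (neg φ) = vars φ
vars (φ ⇒ ψ) = vars φ ++ vars ψ
vars ([U] φ) = vars φ

AgreeOn-sym : ∀ {Φ w₁ w₂} → AgreeOn Φ w₁ w₂ → AgreeOn Φ w₂ w₁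
AgreeOn-sym w₁≈w₂ p p∈Φ = sym (w₁≈w₂ p p∈Φ)

module _ {Φ : List PROP} {W₁ W₂ : SDModel} (W₁≈W₂ : PhiEquivalent Φ W₁ W₂) where

  ⊨-invariant : ∀ φ → vars φ ⊆ Φ → ∀ {w₁ w₂} → AgreeOn Φ w₁ w₂ →
                (W₁ ∣ w₁ ⊨ φ) ⇔ (W₂ ∣ w₂ ⊨ φ)
  ⊨-invariant (var p) vars⊆Φ w₁≈w₂ = mk⇔ (trans (sym p-agrees)) (trans p-agrees)
    where p-agrees = w₁≈w₂ p (vars⊆Φ (here refl))
  ⊨-invariant (neg φ) vars⊆Φ w₁≈w₂ = mk⇔ (λ ¬φ₁ → ¬φ₁ ∘ from ih) (λ ¬φ₂ → ¬φ₂ ∘ to ih)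
    where ih = ⊨-invariant φ vars⊆Φ w₁≈w₂
  ⊨-invariant (φ ⇒ ψ) vars⊆Φ w₁≈w₂ =
    mk⇔ (λ f → to ihψ ∘ f ∘ from ihφ) (λ f → from ihψ ∘ f ∘ to ihφ)
    where
    ihφ = ⊨-invariant φ (⊆-trans (xs⊆xs++ys (vars φ) (vars ψ)) vars⊆Φ) w₁≈w₂
    ihψ = ⊨-invariant ψ (⊆-trans (xs⊆ys++xs (vars ψ) (vars φ)) vars⊆Φ) w₁≈w₂
  ⊨-invariant ([U] φ) vars⊆Φ _ = mk⇔
    (λ □φ₁ u₂ W₂u₂ → let u₁ , W₁u₁ , u₁≈u₂ = proj₂ W₁≈W₂ u₂ W₂u₂
                     in to (⊨-invariant φ vars⊆Φ u₁≈u₂) (□φ₁ u₁ W₁u₁))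
    (λ □φ₂ u₁ W₁u₁ → let u₂ , W₂u₂ , u₁≈u₂ = proj₁ W₁≈W₂ u₁ W₁u₁
                     in from (⊨-invariant φ vars⊆Φ u₁≈u₂) (□φ₂ u₂ W₂u₂))

definable⇒closedFPE : ∀ {ℓ} (C : Class ℓ) → Definable C → ClosedFPE C
definable⇒closedFPE C (φ , defines) =
  (λ W empty → proj₁ (defines W) (λ w Ww → ⊥-elim (empty w Ww))) ,
  (vars φ , λ W₁ W₂ _ _ W₁∈C W₁≈W₂ → proj₁ (defines W₂) λ w₂ W₂w₂ →
     let w₁ , W₁w₁ , w₁≈w₂ = proj₂ W₁≈W₂ w₂ W₂w₂
     in to (⊨-invariant W₁≈W₂ φ ⊆-refl w₁≈w₂) (proj₂ (defines W₁) W₁∈C w₁ W₁w₁))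

_[_≔_] : Assignment → PROP → Bool → Assignment
(t [ p ≔ b ]) q with q ≟ p
... | yes _ = b
... | no _  = t q

-- One assignment per Φ-type (all of them false outside Φ).
representatives : List PROP → List Assignment
representatives []      = (λ _ → false) ∷ []
representatives (p ∷ Ψ) =
  map (_[ p ≔ true ]) (representatives Ψ) ++ map (_[ p ≔ false ]) (representatives Ψ)

update-∈-representatives : ∀ {p} Ψ {t} b → t ∈ representatives Ψ →
                           t [ p ≔ b ] ∈ representatives (p ∷ Ψ)
update-∈-representatives Ψ true  t∈ = ∈-++⁺ˡ (∈-map⁺ _ t∈)
update-∈-representatives Ψ false t∈ = ∈-++⁺ʳ _ (∈-map⁺ _ t∈)

AgreeOn-update : ∀ {p Ψ t} w → AgreeOn Ψ w t → AgreeOn (p ∷ Ψ) w (t [ p ≔ w p ])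
AgreeOn-update {p} w w≈t q q∈ with q ≟ p | q∈
... | yes refl | _         = refl
... | no q≢p   | here q≡p  = ⊥-elim (q≢p q≡p)
... | no _     | there q∈Ψ = w≈t q q∈Ψ

representatives-cover : ∀ Ψ w → ∃ λ t → t ∈ representatives Ψ × AgreeOn Ψ w t
representatives-cover []      w = (λ _ → false) , here refl , λ _ ()
representatives-cover (p ∷ Ψ) w =
  let t , t∈ , w≈t = representatives-cover Ψ w
  in t [ p ≔ w p ] , update-∈-representatives Ψ (w p) t∈ , AgreeOn-update w w≈t

Realizes : List PROP → SDModel → Assignment → Set
Realizes Φ W t = ∃ λ w → W w × AgreeOn Φ w t

⊤ᶠ ⊥ᶠ : Form
⊤ᶠ = var 0 ⇒ var 0
⊥ᶠ = neg ⊤ᶠ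

infixr 15 _∧ᶠ_
infix 25 ◇_

_∧ᶠ_ : Form → Form → Form
φ ∧ᶠ ψ = neg (φ ⇒ neg ψ)

◇_ : Form → Form
◇ φ = neg ([U] neg φ)

literal : PROP → Bool → Form
literal p true  = var p
literal p false = neg (var p)

⊨literal⇔ : ∀ p b → (W ∣ w ⊨ literal p b) ⇔ (w p ≡ b)
⊨literal⇔ p true  = mk⇔ (λ wp≡b → wp≡b) (λ wp≡b → wp≡b)
⊨literal⇔ p false = mk⇔ ¬-not not-¬

χ : List PROP → Assignment → Form
χ []      t = ⊤ᶠ
χ (p ∷ Ψ) t = literal p (t p) ∧ᶠ χ Ψ t

verdict : ∀ {a} {A : Set a} → A ⊎ ¬ A → Form
verdict (inj₁ _) = ⊤ᶠ
verdict (inj₂ _) = ⊥ᶠ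

⊨verdict⇔ : ∀ {a} {A : Set a} (d : A ⊎ ¬ A) → (W ∣ w ⊨ verdict d) ⇔ A
⊨verdict⇔ (inj₁ a)  = mk⇔ (λ _ → a) (λ _ x → x)
⊨verdict⇔ (inj₂ ¬a) = mk⇔ (λ ⊨⊥ → ⊥-elim (⊨⊥ (λ x → x))) (⊥-elim ∘ ¬a)

HasValue : Set → Bool → Set
HasValue A true  = A
HasValue A false = ¬ A

HasValue-transfer : ∀ {A B} b → HasValue A b → HasValue B b → A → B
HasValue-transfer true  _  b _ = b
HasValue-transfer false ¬a _ a = ⊥-elim (¬a a)

-- A profile records, for some Φ-types, whether a model realizes them.
Profile : Set
Profile = List (Assignment × Bool)

module _ (Φ : List PROP) where

  Fits : SDModel → Profile → Set
  Fits W π = All (λ (t , b) → HasValue (Realizes Φ W t) b) π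

  -- Every assignment has its Φ-type either still pending in ts or recorded in π.
  Covers : List Assignment → Profile → Set
  Covers ts π = ∀ w → ∃ λ t → AgreeOn Φ w t × (t ∈ ts ⊎ ∃ λ b → (t , b) ∈ π)

  Covers-record : ∀ {t ts π} b → Covers (t ∷ ts) π → Covers ts ((t , b) ∷ π)
  Covers-record b covers w with covers w
  ... | t , w≈t , inj₁ (here refl)    = t , w≈t , inj₂ (b , here refl)
  ... | t , w≈t , inj₁ (there t∈ts)   = t , w≈t , inj₁ t∈ts
  ... | t , w≈t , inj₂ (b′ , tb′∈π) = t , w≈t , inj₂ (b′ , there tb′∈π)

  Covers-representatives : Covers (representatives Φ) []
  Covers-representatives w =
    let t , t∈ , w≈t = representatives-cover Φ w in t , w≈t , inj₁ t∈

  Fits-simulate : ∀ {W₁ W₂ π} → Fits W₁ π → Fits W₂ π → Covers [] π →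
                  ∀ w₁ → W₁ w₁ → ∃ λ w₂ → W₂ w₂ × AgreeOn Φ w₁ w₂
  Fits-simulate fits₁ fits₂ covers w₁ W₁w₁ with covers w₁
  ... | t , w₁≈t , inj₂ (b , tb∈π) =
    let w₂ , W₂w₂ , w₂≈t = HasValue-transfer b (lookup fits₁ tb∈π) (lookup fits₂ tb∈π)
                             (w₁ , W₁w₁ , w₁≈t)
    in w₂ , W₂w₂ , λ q q∈Φ → trans (w₁≈t q q∈Φ) (sym (w₂≈t q q∈Φ))

  Fits⇒PhiEquivalent : ∀ {W₁ W₂ π} → Fits W₁ π → Fits W₂ π → Covers [] π →
                       PhiEquivalent Φ W₁ W₂
  Fits⇒PhiEquivalent fits₁ fits₂ covers =
    Fits-simulate fits₁ fits₂ covers ,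
    λ w₂ W₂w₂ → let w₁ , W₁w₁ , w₂≈w₁ = Fits-simulate fits₂ fits₁ covers w₂ W₂w₂
                in w₁ , W₁w₁ , AgreeOn-sym w₂≈w₁

module Classical (em : ExcludedMiddle) where

  ¬¬-elim : ∀ {a} {A : Set a} → ¬ ¬ A → A
  ¬¬-elim {A = A} ¬¬a with em A
  ... | inj₁ a  = a
  ... | inj₂ ¬a = ⊥-elim (¬¬a ¬a)

  ⊨∧⇔ : ∀ φ ψ → (W ∣ w ⊨ φ ∧ᶠ ψ) ⇔ (W ∣ w ⊨ φ × W ∣ w ⊨ ψ)
  ⊨∧⇔ φ ψ = mk⇔
    (λ φ∧ψ → ¬¬-elim (λ ¬φ → φ∧ψ (⊥-elim ∘ ¬φ)) , ¬¬-elim (λ ¬ψ → φ∧ψ (λ _ → ¬ψ)))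
    (λ (φ-holds , ψ-holds) f → f φ-holds ψ-holds)

  ⊨χ⇔AgreeOn : ∀ Ψ t → (W ∣ w ⊨ χ Ψ t) ⇔ AgreeOn Ψ w t
  ⊨χ⇔AgreeOn []      t = mk⇔ (λ _ _ ()) (λ _ x → x)
  ⊨χ⇔AgreeOn (p ∷ Ψ) t = mk⇔
    (λ χ-holds → let head , rest = to (⊨∧⇔ (literal p (t p)) (χ Ψ t)) χ-holds in λ where
       q (here refl)  → to (⊨literal⇔ p (t p)) head
       q (there q∈Ψ) → to (⊨χ⇔AgreeOn Ψ t) rest q q∈Ψ)
    (λ w≈t → from (⊨∧⇔ (literal p (t p)) (χ Ψ t))
               (from (⊨literal⇔ p (t p)) (w≈t p (here refl)) ,
                from (⊨χ⇔AgreeOn Ψ t) (λ q → w≈t q ∘ there)))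

  ⊨◇χ⇔Realizes : ∀ Φ t w → (W ∣ w ⊨ ◇ χ Φ t) ⇔ Realizes Φ W t
  ⊨◇χ⇔Realizes {W} Φ t _ = mk⇔
    (λ ◇χ-holds → ¬¬-elim λ unrealized →
       ◇χ-holds λ u Wu χ-at-u → unrealized (u , Wu , to (⊨χ⇔AgreeOn Φ t) χ-at-u))
    (λ (u , Wu , u≈t) □¬χ → □¬χ u Wu (from (⊨χ⇔AgreeOn Φ t) u≈t))

  module _ {ℓ : Level} (C : Class ℓ) (Φ : List PROP) where

    Attained : Profile → Set _
    Attained π = ∃ λ W → Nonempty W × C W × Fits Φ W π

    tree : List Assignment → Profile → Form
    tree []       π = verdict (em (Attained π))
    tree (t ∷ ts) π = (◇ χ Φ t ⇒ tree ts ((t , true) ∷ π))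
                   ∧ᶠ (neg (◇ χ Φ t) ⇒ tree ts ((t , false) ∷ π))

    ⊨tree-∷⇔ : ∀ t ts π → (W ∣ w ⊨ tree (t ∷ ts) π) ⇔
                 ((W ∣ w ⊨ ◇ χ Φ t → W ∣ w ⊨ tree ts ((t , true) ∷ π)) ×
                  (¬ W ∣ w ⊨ ◇ χ Φ t → W ∣ w ⊨ tree ts ((t , false) ∷ π)))
    ⊨tree-∷⇔ t ts π = ⊨∧⇔ (◇ χ Φ t ⇒ tree ts _) (neg (◇ χ Φ t) ⇒ tree ts _)

    tree-sound : (∀ W₁ W₂ → Nonempty W₁ → Nonempty W₂ → C W₁ → PhiEquivalent Φ W₁ W₂ → C W₂) →
                 ∀ ts π → W w → Fits Φ W π → Covers Φ ts π → W ∣ w ⊨ tree ts π → C W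
    tree-sound {W} {w} closed [] π Ww fits covers tree-holds =
      let W′ , W′-nonempty , W′∈C , fits′ = to (⊨verdict⇔ (em (Attained π))) tree-holds
      in closed W′ W W′-nonempty (w , Ww) W′∈C (Fits⇒PhiEquivalent Φ fits′ fits covers)
    tree-sound {W} {w} closed (t ∷ ts) π Ww fits covers tree-holds with em (Realizes Φ W t)
    ... | inj₁ realized =
      tree-sound closed ts _ Ww (realized ∷ fits) (Covers-record Φ true covers)
        (proj₁ (to (⊨tree-∷⇔ t ts π) tree-holds) (from (⊨◇χ⇔Realizes Φ t w) realized))
    ... | inj₂ unrealized =
      tree-sound closed ts _ Ww (unrealized ∷ fits) (Covers-record Φ false covers)
        (proj₂ (to (⊨tree-∷⇔ t ts π) tree-holds) (unrealized ∘ to (⊨◇χ⇔Realizes Φ t w)))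

    tree-complete : ∀ ts π → W w → C W → Fits Φ W π → W ∣ w ⊨ tree ts π
    tree-complete {W} {w} [] π Ww W∈C fits =
      from (⊨verdict⇔ (em (Attained π))) (W , (w , Ww) , W∈C , fits)
    tree-complete {w = w} (t ∷ ts) π Ww W∈C fits = from (⊨tree-∷⇔ t ts π)
      ( (λ ◇χ → tree-complete ts _ Ww W∈C (to (⊨◇χ⇔Realizes Φ t w) ◇χ ∷ fits))
      , (λ ¬◇χ → tree-complete ts _ Ww W∈C ((¬◇χ ∘ from (⊨◇χ⇔Realizes Φ t w)) ∷ fits)))

  closedFPE⇒definable : ∀ {ℓ} (C : Class ℓ) → ClosedFPE C → Definable C
  closedFPE⇒definable C (C-empty , Φ , closed) = φ , λ W → ⊨⇒C W , C⇒⊨ W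
    where
    φ = tree C Φ (representatives Φ) []

    ⊨⇒C : ∀ W → W ⊨ φ → C W
    ⊨⇒C W φ-valid with em (Nonempty W)
    ... | inj₁ (w , Ww) =
      tree-sound C Φ closed _ [] Ww [] (Covers-representatives Φ) (φ-valid w Ww)
    ... | inj₂ empty = C-empty W (λ w Ww → empty (w , Ww))

    C⇒⊨ : ∀ W → C W → W ⊨ φ
    C⇒⊨ W W∈C w Ww = tree-complete C Φ (representatives Φ) [] Ww W∈C []

proposition3p7 : ExcludedMiddle → ∀ {ℓ : Level} (C : Class ℓ) →
                   (Definable C → ClosedFPE C) × (ClosedFPE C → Definable C)
proposition3p7 em C = definable⇒closedFPE C , Classical.closedFPE⇒definable em C
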